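{- Let $G$ be an interval graph. If $G$ contains the forbidden pattern $\mathtt{F}$ as an induced subgraph, i.e. there exist an integer $k\ge1$ and an induced path $P$ of $G$ on $k$ vertices whose open neighbourhood contains an independent set of at least $k+3$ vertices, then $G$ is not an exactly hittable interval graph.
   Context: All graphs are finite and simple. An interval graph is a graph $G=(V,E)$ for which there are intervals $I_v$, $v\in V$, such that for distinct $u,v$, $uv\in E$ iff $I_u\cap I_v\neq\emptyset$. $G$ is an exactly hittable interval graph if it has such a representation by discrete intervals $I_v\subseteq[n]$ for which there is a set $S\subseteq[n]$ with $|S\cap I_v|=1$ for all $v\in V$. The open neighbourhood of a vertex set $P$ is the set of vertices outside $P$ adjacent to at least one vertex of $P$. -}

module Defs where

open import Data.Nat using (ℕ; suc; _≤_; _+_)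
open import Data.Fin using (Fin; toℕ)
open import Data.Bool using (Bool; true)
open import Data.Product using (Σ; ∃; _×_; _,_)
open import Data.Sum using (_⊎_)
open import Data.Empty using (⊥)
open import Relation.Nullary using (¬_)
open import Relation.Binary.PropositionalEquality using (_≡_)
open import Function.Definitions using (Injective)
open import Level using (0ℓ)
open import Relation.Binary.Core using (Rel)

record Graph : Set₁ where
  field
    n      : ℕ
    Adj    : Fin n → Fin n → Set
    sym    : ∀ {u v} → Adj u v → Adj v u
    irrefl : ∀ {v} → ¬ Adj v v
open Graph public

record Interval (m : ℕ) : Set where
  constructor [_,_]⟨_,_,_⟩
  field
    lo hi : ℕ
    1≤lo  : 1 ≤ lo
    lo≤hi : lo ≤ hi
    hi≤m  : hi ≤ m
open Interval public

_∈I_ : ∀ {m} → ℕ → Interval m → Set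
x ∈I I = lo I ≤ x × x ≤ hi I

Meets : ∀ {m} → Interval m → Interval m → Set
Meets I J = ∃ λ x → x ∈I I × x ∈I J

IsIntervalRep : (G : Graph) (m : ℕ) → (Fin (n G) → Interval m) → Set
IsIntervalRep G m I =
  ∀ u v → ¬ u ≡ v → (Adj G u v → Meets (I u) (I v)) × (Meets (I u) (I v) → Adj G u v)

IsIntervalGraph : Graph → Set
IsIntervalGraph G = Σ ℕ λ m → Σ (Fin (n G) → Interval m) λ I → IsIntervalRep G m I

HitsExactlyOnce : ∀ {m} → (ℕ → Bool) → Interval m → Set
HitsExactlyOnce S I =
  ∃ λ x → x ∈I I × S x ≡ true × (∀ y → y ∈I I → S y ≡ true → y ≡ x)

IsExactlyHittable : Graph → Set
IsExactlyHittable G =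
  Σ ℕ λ m → Σ (Fin (n G) → Interval m) λ I → IsIntervalRep G m I ×
    Σ (ℕ → Bool) λ S → (∀ x → S x ≡ true → 1 ≤ x × x ≤ m) × (∀ v → HitsExactlyOnce S (I v))

Consecutive : ∀ {k} → Fin k → Fin k → Set
Consecutive i j = suc (toℕ i) ≡ toℕ j ⊎ suc (toℕ j) ≡ toℕ i

IsInducedPath : (G : Graph) (k : ℕ) → (Fin k → Fin (n G)) → Set
IsInducedPath G k p =
  Injective _≡_ _≡_ p × (∀ i j → (Adj G (p i) (p j) → Consecutive i j) × (Consecutive i j → Adj G (p i) (p j)))

InOpenNbhd : (G : Graph) {k : ℕ} → (Fin k → Fin (n G)) → Fin (n G) → Set
InOpenNbhd G {k} p v = (∀ i → ¬ v ≡ p i) × ∃ λ i → Adj G v (p i)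

IsIndependent : (G : Graph) {s : ℕ} → (Fin s → Fin (n G)) → Set
IsIndependent G q = Injective _≡_ _≡_ q × (∀ i j → ¬ Adj G (q i) (q j))

ContainsF : Graph → Set
ContainsF G =
  Σ ℕ λ k → 1 ≤ k × Σ (Fin k → Fin (n G)) λ p → IsInducedPath G k p ×
    Σ ℕ λ s → k + 3 ≤ s × Σ (Fin s → Fin (n G)) λ q →
      IsIndependent G q × (∀ j → InOpenNbhd G p (q j))

-- Let G have an interval representation I with a set S hitting every
-- interval exactly once, and write h v for the point of S in I v.  Suppose
-- p is an induced path on K ≥ 1 vertices and q an independent set of size
-- s in the open neighbourhood of p.  The intervals of q are pairwise
-- disjoint, so the points h (q j) are pairwise distinct.  Take the
-- independent vertices qmin and qmax with the smallest and largest hitting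
-- point.  Both are adjacent to the path, and since I qmin and I qmax avoid
-- every other I (q j), their contacts with the path lie left resp. right of
-- h (q j).  The intervals of a path form a chain of overlapping intervals,
-- so their union is convex, hence contains h (q j); thus h (q j) = h (p i)
-- for some i.  Consequently the s distinct points h (q j) are among the
-- K + 2 values h qmin, h qmax, h (p i), forcing s ≤ K + 2 < K + 3.
module Submission where

open import Defs hiding (sym)
open import Data.Nat using (ℕ; zero; suc; _≤_; _+_; s≤s)
open import Data.Nat.Properties using (≤-trans; ≤-total; +-comm; +-cancelˡ-≤)
open import Data.Fin using (Fin; inject₁) renaming (zero to fz; suc to fs)
open import Data.Fin.Properties using (_≟_; toℕ-inject₁; injective⇒≤)
open import Data.List using (allFin)
open import Data.List.Membership.Propositional.Properties using (∈-allFin)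
open import Data.List.Extrema.Nat using (argmin; argmax; f[argmin]≤f[xs]; f[xs]≤f[argmax])
import Data.List.Relation.Unary.All as All
open import Data.Bool using (Bool; true)
open import Data.Product using (∃; _×_; _,_; proj₁; proj₂)
open import Data.Sum using (_⊎_; inj₁; inj₂; [_,_])
open import Data.Empty using (⊥-elim)
open import Function using (_∘_)
open import Function.Definitions using (Injective)
open import Relation.Nullary using (¬_; Dec; yes; no)
open import Relation.Binary.PropositionalEquality
  using (_≡_; _≢_; refl; sym; cong; subst; module ≡-Reasoning)

Convex : (ℕ → Set) → Set
Convex A = ∀ {a b x} → A a → A b → a ≤ x → x ≤ b → A x

interval-convex : ∀ {m} (I : Interval m) → Convex (λ x → x ∈I I)
interval-convex I (lo≤a , _) (_ , b≤hi) a≤x x≤b = ≤-trans lo≤a a≤x , ≤-trans x≤b b≤hi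

convex-resp : ∀ {A B : ℕ → Set} →
  (∀ {x} → A x → B x) → (∀ {x} → B x → A x) → Convex A → Convex B
convex-resp A⇒B B⇒A convexA a b a≤x x≤b = A⇒B (convexA (B⇒A a) (B⇒A b) a≤x x≤b)

-- Two convex sets sharing a point y have a convex union: a point between
-- members of different sets lies on the side of y of one of them.
∪-convex : ∀ {A B : ℕ → Set} → Convex A → Convex B →
  (∃ λ y → A y × B y) → Convex (λ x → A x ⊎ B x)
∪-convex cA cB _ (inj₁ a) (inj₁ b) a≤x x≤b = inj₁ (cA a b a≤x x≤b)
∪-convex cA cB _ (inj₂ a) (inj₂ b) a≤x x≤b = inj₂ (cB a b a≤x x≤b)
∪-convex cA cB (y , Ay , By) {x = x} (inj₁ a) (inj₂ b) a≤x x≤b with ≤-total x y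
... | inj₁ x≤y = inj₁ (cA a Ay a≤x x≤y)
... | inj₂ y≤x = inj₂ (cB By b y≤x x≤b)
∪-convex cA cB (y , Ay , By) {x = x} (inj₂ a) (inj₁ b) a≤x x≤b with ≤-total x y
... | inj₁ x≤y = inj₂ (cB a By a≤x x≤y)
... | inj₂ y≤x = inj₁ (cA Ay b y≤x x≤b)

⋃ : ∀ {k} → (Fin k → ℕ → Set) → ℕ → Set
⋃ A x = ∃ λ i → A i x

IsChain : ∀ {k} → (Fin (suc k) → ℕ → Set) → Set
IsChain {k} A = ∀ (i : Fin k) → ∃ λ y → A (inject₁ i) y × A (fs i) y

chain-convex : ∀ {k} (A : Fin (suc k) → ℕ → Set) →
  (∀ i → Convex (A i)) → IsChain A → Convex (⋃ A)
chain-convex {zero} A convex _ =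
  convex-resp (fz ,_) (λ { (fz , a) → a ; (fs () , _) }) (convex fz)
chain-convex {suc k} A convex chain =
  convex-resp [ (fz ,_) , (λ { (i , a) → fs i , a }) ]
              (λ { (fz , a) → inj₁ a ; (fs i , a) → inj₂ (i , a) })
              (∪-convex (convex fz) (chain-convex (A ∘ fs) (convex ∘ fs) (chain ∘ fs)) shared)
  where
  shared : ∃ λ y → A fz y × ⋃ (A ∘ fs) y
  shared with chain fz
  ... | y , a₀ , a₁ = y , a₀ , fz , a₁

-- If a point x of I is left of a point y of a disjoint interval J, then all
-- of I is left of y (otherwise y would lie between two points of I).
left-of-disjoint : ∀ {m} {I J : Interval m} {x y z} →
  ¬ Meets I J → x ∈I I → y ∈I J → x ≤ y → z ∈I I → z ≤ y
left-of-disjoint {I = I} {y = y} {z = z} disjoint x∈I y∈J x≤y z∈I with ≤-total z y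
... | inj₁ z≤y = z≤y
... | inj₂ y≤z = ⊥-elim (disjoint (_ , interval-convex I x∈I z∈I x≤y y≤z , y∈J))

right-of-disjoint : ∀ {m} {I J : Interval m} {x y z} →
  ¬ Meets I J → x ∈I I → y ∈I J → y ≤ x → z ∈I I → y ≤ z
right-of-disjoint {I = I} {y = y} {z = z} disjoint x∈I y∈J y≤x z∈I with ≤-total y z
... | inj₁ y≤z = y≤z
... | inj₂ z≤y = ⊥-elim (disjoint (_ , interval-convex I z∈I x∈I z≤y y≤x , y∈J))

-- If an injective g : Fin s → A only takes values of c : Fin t → A, then
-- s ≤ t: choosing for every j an index of g j in c is an injection.
injective-into-image⇒≤ : ∀ {A : Set} {s t : ℕ} (g : Fin s → A) (c : Fin t → A) →
  Injective _≡_ _≡_ g → (∀ j → ∃ λ i → g j ≡ c i) → s ≤ t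
injective-into-image⇒≤ {s = s} {t = t} g c g-injective image = injective⇒≤ index-injective
  where
  index : Fin s → Fin t
  index j = proj₁ (image j)

  index-injective : Injective _≡_ _≡_ index
  index-injective {i} {j} eq = g-injective (begin
    g i           ≡⟨ proj₂ (image i) ⟩
    c (index i)   ≡⟨ cong c eq ⟩
    c (index j)   ≡⟨ sym (proj₂ (image j)) ⟩
    g j           ∎)
    where open ≡-Reasoning

induced-path-adjacent : ∀ {G k p} → IsInducedPath G (suc k) p →
  ∀ (i : Fin k) → Adj G (p (inject₁ i)) (p (fs i))
induced-path-adjacent (_ , adjacency) i =
  proj₂ (adjacency (inject₁ i) (fs i)) (inj₁ (cong suc (toℕ-inject₁ i)))

module IntervalRepresentation {G : Graph} {m} {I : Fin (n G) → Interval m}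
  (rep : IsIntervalRep G m I) where

  adjacent⇒meet : ∀ {u v} → Adj G u v → Meets (I u) (I v)
  adjacent⇒meet {u} {v} adj = proj₁ (rep u v λ { refl → irrefl G adj }) adj

  nonadjacent⇒disjoint : ∀ {u v} → u ≢ v → ¬ Adj G u v → ¬ Meets (I u) (I v)
  nonadjacent⇒disjoint {u} {v} u≢v ¬adj meet = ¬adj (proj₂ (rep u v u≢v) meet)

  -- The intervals along a walk form a chain, so together they cover a
  -- convex set.
  walk-convex : ∀ {k} {p : Fin (suc k) → Fin (n G)} →
    (∀ (i : Fin k) → Adj G (p (inject₁ i)) (p (fs i))) →
    Convex (⋃ λ i x → x ∈I I (p i))
  walk-convex {p = p} adjacent =
    chain-convex _ (λ i → interval-convex (I (p i))) (adjacent⇒meet ∘ adjacent)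

module ExactHitting {m} {V : Set} (I : V → Interval m) (S : ℕ → Bool)
  (hit : ∀ v → HitsExactlyOnce S (I v)) where

  hitpoint : V → ℕ
  hitpoint v = proj₁ (hit v)

  hitpoint∈ : ∀ v → hitpoint v ∈I I v
  hitpoint∈ v = proj₁ (proj₂ (hit v))

  hitpoint-selected : ∀ v → S (hitpoint v) ≡ true
  hitpoint-selected v = proj₁ (proj₂ (proj₂ (hit v)))

  hitpoint-unique : ∀ v {x} → x ∈I I v → S x ≡ true → x ≡ hitpoint v
  hitpoint-unique v x∈I x∈S = proj₂ (proj₂ (proj₂ (hit v))) _ x∈I x∈S

  disjoint⇒distinct : ∀ {u v} → ¬ Meets (I u) (I v) → hitpoint u ≢ hitpoint v
  disjoint⇒distinct {u} {v} disjoint eq =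
    disjoint (hitpoint u , hitpoint∈ u , subst (λ x → x ∈I I v) (sym eq) (hitpoint∈ v))

module ForbiddenPattern {G : Graph} {m} {I : Fin (n G) → Interval m}
  (rep : IsIntervalRep G m I) {S : ℕ → Bool} (hit : ∀ v → HitsExactlyOnce S (I v))
  {k} {p : Fin (suc k) → Fin (n G)} (path : IsInducedPath G (suc k) p)
  {s} {q : Fin (suc s) → Fin (n G)} (independent : IsIndependent G q)
  (neighbourhood : ∀ j → InOpenNbhd G p (q j)) where

  open IntervalRepresentation {G} {m} {I} rep
  open ExactHitting I S hit

  q-disjoint : ∀ {i j} → i ≢ j → ¬ Meets (I (q i)) (I (q j))
  q-disjoint i≢j = nonadjacent⇒disjoint (i≢j ∘ proj₁ independent) (proj₂ independent _ _)

  hq : Fin (suc s) → ℕ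
  hq j = hitpoint (q j)

  hq-injective : Injective _≡_ _≡_ hq
  hq-injective {i} {j} eq with i ≟ j
  ... | yes i≡j = i≡j
  ... | no i≢j = ⊥-elim (disjoint⇒distinct (q-disjoint i≢j) eq)

  jmin jmax : Fin (suc s)
  jmin = argmin hq fz (allFin _)
  jmax = argmax hq fz (allFin _)

  hq-min : ∀ j → hq jmin ≤ hq j
  hq-min j = All.lookup (f[argmin]≤f[xs] {f = hq} fz (allFin _)) (∈-allFin j)

  hq-max : ∀ j → hq j ≤ hq jmax
  hq-max j = All.lookup (f[xs]≤f[argmax] {f = hq} fz (allFin _)) (∈-allFin j)

  PathUnion : ℕ → Set
  PathUnion = ⋃ λ i x → x ∈I I (p i)

  path-left-of : ∀ j → j ≢ jmin → ∃ λ a → PathUnion a × a ≤ hq j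
  path-left-of j j≢jmin =
    let a , a∈qmin , a∈p = adjacent⇒meet (proj₂ (proj₂ (neighbourhood jmin)))
    in a , (_ , a∈p) ,
       left-of-disjoint {I = I (q jmin)} {J = I (q j)} (q-disjoint (j≢jmin ∘ sym))
         (hitpoint∈ (q jmin)) (hitpoint∈ (q j)) (hq-min j) a∈qmin

  path-right-of : ∀ j → j ≢ jmax → ∃ λ b → PathUnion b × hq j ≤ b
  path-right-of j j≢jmax =
    let b , b∈qmax , b∈p = adjacent⇒meet (proj₂ (proj₂ (neighbourhood jmax)))
    in b , (_ , b∈p) ,
       right-of-disjoint {I = I (q jmax)} {J = I (q j)} (q-disjoint (j≢jmax ∘ sym))
         (hitpoint∈ (q jmax)) (hitpoint∈ (q j)) (hq-max j) b∈qmax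

  -- By convexity of the path union, every non-extreme hitting point of q
  -- is the hitting point of a path vertex.
  middle-hits-path : ∀ j → j ≢ jmin → j ≢ jmax → ∃ λ i → hq j ≡ hitpoint (p i)
  middle-hits-path j j≢jmin j≢jmax =
    let a , a∈P , a≤hq = path-left-of j j≢jmin
        b , b∈P , hq≤b = path-right-of j j≢jmax
        i , hq∈p = walk-convex {p = p} (induced-path-adjacent {G} {k} {p} path) a∈P b∈P a≤hq hq≤b
    in i , hitpoint-unique (p i) hq∈p (hitpoint-selected (q j))

  candidate : Fin (2 + suc k) → ℕ
  candidate fz = hq jmin
  candidate (fs fz) = hq jmax
  candidate (fs (fs i)) = hitpoint (p i)

  hq-candidate : ∀ j → ∃ λ i → hq j ≡ candidate i
  hq-candidate j = classify (j ≟ jmin) (j ≟ jmax)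
    where
    classify : Dec (j ≡ jmin) → Dec (j ≡ jmax) → ∃ λ i → hq j ≡ candidate i
    classify (yes j≡jmin) _            = fz , cong hq j≡jmin
    classify (no _)       (yes j≡jmax) = fs fz , cong hq j≡jmax
    classify (no j≢jmin)  (no j≢jmax)  =
      let i , eq = middle-hits-path j j≢jmin j≢jmax in fs (fs i) , eq

  independent-bound : suc s ≤ 2 + suc k
  independent-bound = injective-into-image⇒≤ hq candidate hq-injective hq-candidate

-- A path on K = k + 1 vertices with an independent set of size ≥ K + 3 in
-- its open neighbourhood contradicts the bound of ForbiddenPattern; the
-- exact hitting representation is itself an interval representation.
lemma13 : (G : Graph) → IsIntervalGraph G → ContainsF G → ¬ IsExactlyHittable G
lemma13 G _ (zero , () , _)
lemma13 G _ (suc k , _ , p , path , zero , () , _)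
lemma13 G _ (suc k , _ , p , path , suc s , K+3≤s , q , independent , neighbourhood)
             (m , I , rep , S , _ , hit) = 3≰2 (+-cancelˡ-≤ (suc k) 3 2 K+3≤K+2)
  where
  open ForbiddenPattern {G} {I = I} rep {S} hit {p = p} path {q = q} independent neighbourhood

  K+3≤K+2 : suc k + 3 ≤ suc k + 2
  K+3≤K+2 = ≤-trans K+3≤s (subst (suc s ≤_) (+-comm 2 (suc k)) independent-bound)

  3≰2 : ¬ 3 ≤ 2
  3≰2 (s≤s (s≤s ()))
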